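{- Let $Q$ be a non-oriented cyclic quiver with vertices $1,2,\dots,n$ labeled cyclically such that vertex $1$ is a source, and let $\sigma(Q)=(a_1,\dots,a_p)$ and $\widetilde{\sigma}(Q)=(b_1,\dots,b_t)$. Then: (1) $\sigma(Q)$ and $\widetilde{\sigma}(Q)$ are skeletal, non-trivial quiddity sequences, i.e. $a_i>1$ and $b_j>1$ for all $i,j$, and not all entries of $\sigma(Q)$, nor all entries of $\widetilde{\sigma}(Q)$, are equal to $2$; (2) $\sum_i a_i+\sum_j b_j=3n$.
   Context: A non-oriented cyclic quiver with vertices $1,\dots,n$ labeled cyclically (indices mod $n$) has one arrow between $i$ and $i+1$ for each $i$, not all oriented in the same cyclic direction. Arrows $i\to i+1$ (including $n\to1$) are increasing, arrows $i+1\to i$ (including $1\to n$) are decreasing; an increasing (decreasing) path is a path of increasing (decreasing) arrows, and its length is its number of arrows. With vertex $1$ a source: let $j_1=1<j_2<\dots<j_p\le n$ be the tails of the decreasing arrows, let $c_{j_k}\ge0$ be the length of the maximal increasing path starting at $j_k$ (for $k=1$, the one starting with $1\to2$), and set $\sigma(Q)=(a_1,\dots,a_p)$ with $a_k=c_{j_k}+2$. Let $2=m_1<m_2<\dots<m_t\le n$ be the heads of the increasing arrows, let $d_k\ge0$ be the length of the maximal decreasing path ending at $m_k$, and set $\widetilde{\sigma}(Q)=(b_1,\dots,b_t)$ with $b_k=d_k+2$. Friezes: given positive integers $(a_i)_{i\in\mathbb{Z}}$, define $a_{i,j}$ ($j\ge i-2$) by $a_{i,i-2}=0$, $a_{i,i-1}=1$,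 $a_{i,i}=a_i$, $a_{i,j}a_{i+1,j+1}-a_{i,j+1}a_{i+1,j}=1$; a finite sequence is a quiddity sequence of an infinite periodic frieze if its periodic extension gives positive integers $a_{i,j}$ for all $j\ge i$. A quiddity sequence is skeletal if no entry equals $1$, and non-trivial if it is not $(2,\dots,2)$. -}

module Defs where

open import Data.Bool using (Bool; true; false; if_then_else_; _≟_)
open import Data.Nat using (ℕ; zero; suc; _+_; _∸_; _%_; _≤_; NonZero)
open import Data.Nat.DivMod using (m%n<n)
open import Data.Fin using (Fin; fromℕ<)
open import Data.List using (List; []; _∷_; [_]; concatMap; upTo; length)
open import Data.Integer using (ℤ; +_; _*_; _-_; 1ℤ; 0ℤ; _%ℕ_) renaming (_+_ to _+ℤ_; _<_ to _<ℤ_)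
open import Data.Product using (Σ; ∃; _×_)
open import Relation.Binary.PropositionalEquality using (_≡_)
open import Relation.Nullary using (yes; no)

-- A quiver on the cyclically labelled vertices 1..n is encoded by
--   o : Fin n → Bool
-- where o k (k = 0..n-1) describes the arrow between vertex k+1 and
-- vertex k+2 (indices mod n, so o (n-1) is the arrow between n and 1):
--   o k = true   : increasing arrow  (k+1) → (k+2)
--   o k = false  : decreasing arrow  (k+2) → (k+1)
-- Internally we use 0-based vertex names u = v - 1, so arrow k joins
-- u = k and u = k+1 (mod n).

arr : ∀ {n} .{{_ : NonZero n}} → (Fin n → Bool) → ℕ → Bool
arr {n} o k = o (fromℕ< (m%n<n k n))

run : ∀ {n} .{{_ : NonZero n}} → (Fin n → Bool) → Bool → ℕ → ℕ → ℕ
run o b k zero = 0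
run o b k (suc fuel) with arr o k ≟ b
... | yes _ = suc (run o b (suc k) fuel)
... | no  _ = 0

NonOriented : ∀ {n} → (Fin n → Bool) → Set
NonOriented {n} o = ∃ λ i → ∃ λ j → o i ≡ true × o j ≡ false

-- Vertex 1 (0-based u = 0) is a source: the arrow 1 → 2 is increasing
-- and the arrow between n and 1 is the decreasing arrow 1 → n.
VertexOneSource : ∀ {n} .{{_ : NonZero n}} → (Fin n → Bool) → Set
VertexOneSource {n} o = arr o 0 ≡ true × arr o (n ∸ 1) ≡ false

prevArr : ∀ {n} .{{_ : NonZero n}} → (Fin n → Bool) → ℕ → Bool
prevArr {n} o u = arr o (u + (n ∸ 1))

-- σ(Q): for every vertex u (in increasing order) that is the tail of a
-- decreasing arrow (i.e. the arrow between u-1 and u is decreasing, u → u-1),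
-- the entry c_u + 2 where c_u = length of the maximal increasing path
-- starting at u (the run of increasing arrows with indices u, u+1, ...).
-- The maximal path has length < n (quiver non-oriented), so fuel n suffices.
sigma : ∀ {n} .{{_ : NonZero n}} → (Fin n → Bool) → List ℕ
sigma {n} o = concatMap f (upTo n)
  where
  f : ℕ → List ℕ
  f u = if prevArr o u then [] else [ run o true u n + 2 ]

-- σ̃(Q): for every vertex u (in increasing order) that is the head of an
-- increasing arrow (the arrow between u-1 and u is increasing, u-1 → u),
-- the entry d_u + 2 where d_u = length of the maximal decreasing path
-- ending at u (... → u+2 → u+1 → u: the run of decreasing arrows with
-- indices u, u+1, ...).
sigmaTilde : ∀ {n} .{{_ : NonZero n}} → (Fin n → Bool) → List ℕ
sigmaTilde {n} o = concatMap f (upTo n)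
  where
  f : ℕ → List ℕ
  f u = if prevArr o u then [ run o false u n + 2 ] else []

at : List ℕ → ℕ → ℕ
at []       _       = 0
at (x ∷ _)  zero    = x
at (_ ∷ xs) (suc i) = at xs i

periodic : (s : List ℕ) .{{_ : NonZero (length s)}} → ℤ → ℕ
periodic s i = at s (i %ℕ length s)

-- f i k  stands for  a_{i, i+k-2}  (so k = 0 ↔ j = i-2, k = 1 ↔ j = i-1).
-- The frieze of (a_i) is an array with a_{i,i-2} = 0, a_{i,i-1} = 1,
-- a_{i,i} = a_i and the diamond rule
--   a_{i,j} a_{i+1,j+1} - a_{i,j+1} a_{i+1,j} = 1   (whenever all four entries
--   are defined, i.e. j ≥ i-1),
-- and s is a quiddity sequence of an infinite periodic frieze iff such an array
-- exists with all entries a_{i,j} (j ≥ i) positive integers.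
IsFriezeArray : (ℤ → ℕ) → (ℤ → ℕ → ℤ) → Set
IsFriezeArray a f =
  (∀ i → f i 0 ≡ 0ℤ) ×
  (∀ i → f i 1 ≡ 1ℤ) ×
  (∀ i → f i 2 ≡ + a i) ×
  (∀ i k → f i (suc k) * f (1ℤ +ℤ i) (suc k) - f i (suc (suc k)) * f (1ℤ +ℤ i) k ≡ 1ℤ)

IsQuiddity : List ℕ → Set
IsQuiddity s =
  Σ (NonZero (length s)) λ nz →
    ∃ λ (f : ℤ → ℕ → ℤ) →
      IsFriezeArray (periodic s {{nz}}) f × (∀ i k → 2 ≤ k → 0ℤ <ℤ f i k)

module Submission where

-- For a skeletal sequence (all entries ≥ 2) the frieze is given by continuants,
-- a_{i,j+1} = a_{j+1} a_{i,j} − a_{i,j−1}: the diamond rule is the determinant identity of this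
-- three-term recurrence, and a_{j+1} ≥ 2 makes every row strictly increasing, hence positive.
-- For the quiver, vertex u contributes exactly one entry, to σ or to σ̃ according to the
-- orientation of the arrow between u − 1 and u, namely 2 plus the length of the run of arrows of
-- the opposite orientation starting at u. That length is the length of a maximal run when u is
-- where the run starts and 0 otherwise, so these lengths add up to n and all entries to 2n + n.
-- Vertex 1, and the first vertex where increasing arrows turn decreasing, give entries ≥ 3.

open import Defs
open import Data.Bool using (Bool; true; false; not; if_then_else_)
open import Data.Bool.Properties using (not-¬)
import Data.Bool as Bool
open import Data.Nat using (ℕ; zero; suc; _<_; _≤_; _*_; _+_; _∸_; _%_; NonZero; z≤n; s≤s; z<s; >-nonZero⁻¹)
open import Data.Nat.Properties
open import Data.Nat.DivMod using (m%n<n; [m+n]%n≡m%n; [m+kn]%n≡m%n; %-distribˡ-+; m%n%n≡m%n; m<n⇒m%n≡m)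
open import Data.Nat.ListAction using (sum)
open import Data.Nat.ListAction.Properties using (sum-++)
open import Data.Nat.Solver using (module +-*-Solver)
open import Data.Integer as ℤ using (ℤ; 0ℤ; 1ℤ)
import Data.Integer.Properties as ℤP
open import Data.Integer.DivMod using (n%ℕd<d)
import Data.Integer.Solver as ℤSolver
open import Data.Fin using (Fin; toℕ)
open import Data.Fin.Properties using (toℕ-injective; toℕ-fromℕ<; fromℕ<-cong; toℕ<n)
open import Data.List using (List; []; _∷_; [_]; length; map; concatMap; upTo; applyUpTo)
open import Data.List.Properties using (map-upTo)
open import Data.List.Relation.Unary.All using (All; []; _∷_)
open import Data.List.Relation.Unary.All.Properties using (concat⁺; concat⁻; applyUpTo⁺₂; applyUpTo⁻)
open import Data.Product using (∃; ∃₂; _×_; _,_)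
open import Data.Empty using (⊥-elim)
open import Relation.Nullary using (¬_; yes; no)
open import Relation.Binary.PropositionalEquality hiding ([_])

module Continuant (a : ℤ → ℕ) where

  open import Data.Integer using (+_; _⊖_; +<+)

  continuant : ℤ → ℕ → ℤ
  continuant i zero          = 0ℤ
  continuant i (suc zero)    = 1ℤ
  continuant i (suc (suc k)) = + a (i ℤ.+ + k) ℤ.* continuant i (suc k) ℤ.- continuant i k

  continuant-diamond : ∀ i k →
    continuant i (suc k) ℤ.* continuant (1ℤ ℤ.+ i) (suc k) ℤ.- continuant i (suc (suc k)) ℤ.* continuant (1ℤ ℤ.+ i) k ≡ 1ℤ
  continuant-diamond i zero =
    solve 1 (λ x → con 1ℤ :* con 1ℤ :- (x :* con 1ℤ :- con 0ℤ) :* con 0ℤ := con 1ℤ) refl (+ a (i ℤ.+ + 0))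
    where open ℤSolver.+-*-Solver
  continuant-diamond i (suc k) = begin
    Y ℤ.* (+ a ((1ℤ ℤ.+ i) ℤ.+ + k) ℤ.* V ℤ.- U) ℤ.- (α ℤ.* Y ℤ.- X) ℤ.* V
      ≡⟨ cong (λ j → Y ℤ.* (+ a j ℤ.* V ℤ.- U) ℤ.- (α ℤ.* Y ℤ.- X) ℤ.* V) shifted-index ⟩
    Y ℤ.* (α ℤ.* V ℤ.- U) ℤ.- (α ℤ.* Y ℤ.- X) ℤ.* V
      ≡⟨ solve 5 (λ α X Y U V → Y :* (α :* V :- U) :- (α :* Y :- X) :* V := X :* V :- Y :* U) refl α X Y U V ⟩
    X ℤ.* V ℤ.- Y ℤ.* U
      ≡⟨ continuant-diamond i k ⟩
    1ℤ ∎
    where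
    open ≡-Reasoning
    open ℤSolver.+-*-Solver
    α X Y U V : ℤ
    α = + a (i ℤ.+ + suc k)
    X = continuant i (suc k)
    Y = continuant i (suc (suc k))
    U = continuant (1ℤ ℤ.+ i) k
    V = continuant (1ℤ ℤ.+ i) (suc k)
    shifted-index : (1ℤ ℤ.+ i) ℤ.+ + k ≡ i ℤ.+ + suc k
    shifted-index = solve 2 (λ i k → (con 1ℤ :+ i) :+ k := i :+ (con 1ℤ :+ k)) refl i (+ k)

  continuant-at-2 : ∀ i → continuant i 2 ≡ + a i
  continuant-at-2 i = trans
    (solve 1 (λ x → x :* con 1ℤ :- con 0ℤ := x) refl (+ a (i ℤ.+ + 0)))
    (cong (λ j → + a j) (ℤP.+-identityʳ i))
    where open ℤSolver.+-*-Solver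

  module _ (skeletal : ∀ i → 2 ≤ a i) where

    continuant-increasing : ∀ i k → ∃₂ λ w x → continuant i k ≡ + w × continuant i (suc k) ≡ + x × w < x
    continuant-increasing i zero = 0 , 1 , refl , refl , z<s
    continuant-increasing i (suc k) with continuant-increasing i k
    ... | w , x , ≡w , ≡x , w<x = x , α * x ∸ w , ≡x , next-≡ , x<next
      where
      α : ℕ
      α = a (i ℤ.+ + k)
      x+x≤αx : x + x ≤ α * x
      x+x≤αx = subst (_≤ α * x) (cong (_+_ x) (+-identityʳ x)) (*-monoˡ-≤ x (skeletal (i ℤ.+ + k)))
      w≤αx : w ≤ α * x
      w≤αx = ≤-trans (<⇒≤ w<x) (≤-trans (m≤m+n x x) x+x≤αx)
      next-≡ : continuant i (suc (suc k)) ≡ + (α * x ∸ w)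
      next-≡ = begin
        + α ℤ.* continuant i (suc k) ℤ.- continuant i k ≡⟨ cong₂ (λ p q → + α ℤ.* p ℤ.- q) ≡x ≡w ⟩
        + α ℤ.* + x ℤ.- + w                             ≡⟨ cong (ℤ._- + w) (sym (ℤP.pos-* α x)) ⟩
        + (α * x) ℤ.- + w                               ≡⟨ ℤP.m-n≡m⊖n (α * x) w ⟩
        (α * x) ⊖ w                                     ≡⟨ ℤP.⊖-≥ w≤αx ⟩
        + (α * x ∸ w)                                   ∎
        where open ≡-Reasoning
      x<next : x < α * x ∸ w
      x<next = +-cancelʳ-< w x (α * x ∸ w)
        (subst (x + w <_) (sym (m∸n+n≡m w≤αx)) (<-≤-trans (+-monoʳ-< x w<x) x+x≤αx))

    continuant-positive : ∀ i k → 2 ≤ k → 0ℤ ℤ.< continuant i k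
    continuant-positive i (suc (suc k)) _ with continuant-increasing i (suc k)
    ... | w , x , _ , ≡x , w<x = subst (0ℤ ℤ.<_) (sym ≡x) (+<+ (≤-<-trans z≤n w<x))
    continuant-positive i (suc zero) (s≤s ())

skeletal⇒frieze : (a : ℤ → ℕ) → (∀ i → 2 ≤ a i) →
  ∃ λ f → IsFriezeArray a f × (∀ i k → 2 ≤ k → 0ℤ ℤ.< f i k)
skeletal⇒frieze a skeletal =
  continuant , ((λ _ → refl) , (λ _ → refl) , continuant-at-2 , continuant-diamond) , continuant-positive skeletal
  where open Continuant a

All-at : ∀ {P : ℕ → Set} {s} → All P s → ∀ {i} → i < length s → P (at s i)
All-at (px ∷ _)  {zero}  _         = px
All-at (_ ∷ ps) {suc i} (s≤s i<n) = All-at ps i<n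

skeletal⇒quiddity : (s : List ℕ) → NonZero (length s) → All (1 <_) s → IsQuiddity s
skeletal⇒quiddity s nz skeletal = nz , skeletal⇒frieze (periodic s {{nz}})
  (λ i → All-at skeletal (n%ℕd<d i (length s) {{nz}}))

sum-concatMap : ∀ {A : Set} (f : A → List ℕ) xs → sum (concatMap f xs) ≡ sum (map (λ x → sum (f x)) xs)
sum-concatMap f []       = refl
sum-concatMap f (x ∷ xs) = trans (sum-++ (f x) (concatMap f xs)) (cong (sum (f x) +_) (sum-concatMap f xs))

sum-map-+ : ∀ {A : Set} (f g : A → ℕ) xs → sum (map f xs) + sum (map g xs) ≡ sum (map (λ x → f x + g x) xs)
sum-map-+ f g []       = refl
sum-map-+ f g (x ∷ xs) = trans
  (solve 4 (λ a b s t → (a :+ s) :+ (b :+ t) := (a :+ b) :+ (s :+ t)) refl (f x) (g x) (sum (map f xs)) (sum (map g xs)))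
  (cong (f x + g x +_) (sum-map-+ f g xs))
  where open +-*-Solver

sum-applyUpTo-telescoping : ∀ (c h : ℕ → ℕ) k n → (∀ u → c u + h u ≡ k + h (suc u)) →
  sum (applyUpTo c n) + h 0 ≡ n * k + h n
sum-applyUpTo-telescoping c h k zero    step = refl
sum-applyUpTo-telescoping c h k (suc n) step = begin
  (c 0 + S) + h 0  ≡⟨ solve 3 (λ a s b → (a :+ s) :+ b := (a :+ b) :+ s) refl (c 0) S (h 0) ⟩
  (c 0 + h 0) + S  ≡⟨ cong (_+ S) (step 0) ⟩
  (k + h 1) + S    ≡⟨ solve 3 (λ k b s → (k :+ b) :+ s := k :+ (s :+ b)) refl k (h 1) S ⟩
  k + (S + h 1)    ≡⟨ cong (k +_) (sum-applyUpTo-telescoping (λ u → c (suc u)) (λ u → h (suc u)) k n (λ u → step (suc u))) ⟩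
  k + (n * k + h (suc n)) ≡⟨ sym (+-assoc k (n * k) _) ⟩
  suc n * k + h (suc n) ∎
  where
  open ≡-Reasoning
  open +-*-Solver
  S : ℕ
  S = sum (applyUpTo (λ u → c (suc u)) n)

module _ {P : ℕ → Set} (f : ℕ → List ℕ) (n : ℕ) where

  All-concatMap-upTo⁺ : (∀ u → All P (f u)) → All P (concatMap f (upTo n))
  All-concatMap-upTo⁺ all-f = concat⁺ (subst (All (All P)) (sym (map-upTo f n)) (applyUpTo⁺₂ f n all-f))

  All-concatMap-upTo⁻ : All P (concatMap f (upTo n)) → ∀ {u} → u < n → All P (f u)
  All-concatMap-upTo⁻ all-concat = applyUpTo⁻ f n (subst (All (All P)) (map-upTo f n) (concat⁻ all-concat))

¬All⇒nonZero-length : ∀ {P : ℕ → Set} xs → ¬ All P xs → NonZero (length xs)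
¬All⇒nonZero-length []      ¬all = ⊥-elim (¬all [])
¬All⇒nonZero-length (_ ∷ _) _    = _

switch-true-false : (g : ℕ → Bool) → g 0 ≡ true → ∀ j → g j ≡ false →
  ∃ λ k → k < j × g k ≡ true × g (suc k) ≡ false
switch-true-false g g0 zero    gj = ⊥-elim (not-¬ g0 gj)
switch-true-false g g0 (suc j) gj with g j in e
... | true  = j , ≤-refl , e , gj
... | false with switch-true-false g g0 j e
...   | k , k<j , gk , gk+1 = k , m≤n⇒m≤1+n k<j , gk , gk+1

module CyclicQuiver {m : ℕ} (o : Fin (suc m) → Bool) where

  n : ℕ
  n = suc m

  arr-periodic : ∀ k → arr o (k + n) ≡ arr o k
  arr-periodic k = cong o (fromℕ<-cong _ _ ([m+n]%n≡m%n k n) _ _)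

  arr-index : ∀ i k → k % n ≡ toℕ i → arr o k ≡ o i
  arr-index i k k%n≡i = cong o (toℕ-injective (trans (toℕ-fromℕ< _) k%n≡i))

  prevArr-suc : ∀ u → prevArr o (suc u) ≡ arr o u
  prevArr-suc u = trans (cong (arr o) (sym (+-suc u m))) (arr-periodic u)

  prevArr-periodic : prevArr o n ≡ prevArr o 0
  prevArr-periodic = trans (cong (arr o) (+-comm n m)) (arr-periodic m)

  run-step : ∀ {b k} f → arr o k ≡ b → run o b k (suc f) ≡ suc (run o b (suc k) f)
  run-step {b} {k} f e with arr o k Bool.≟ b
  ... | yes _ = refl
  ... | no ne = ⊥-elim (ne e)

  run-stop : ∀ {b k} f → arr o k ≢ b → run o b k f ≡ 0
  run-stop zero    ne = refl
  run-stop {b} {k} (suc f) ne with arr o k Bool.≟ b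
  ... | yes e = ⊥-elim (ne e)
  ... | no _  = refl

  run-periodic : ∀ b k f → run o b (k + n) f ≡ run o b k f
  run-periodic b k zero    = refl
  run-periodic b k (suc f) with arr o k Bool.≟ b
  ... | yes e = trans (run-step f (trans (arr-periodic k) e)) (cong suc (run-periodic b (suc k) f))
  ... | no ne = run-stop (suc f) (λ e → ne (trans (sym (arr-periodic k)) e))

  run-suc-fuel : ∀ b k f j → j < f → arr o (k + j) ≢ b → run o b k (suc f) ≡ run o b k f
  run-suc-fuel b k (suc f) j j<f ne with arr o k Bool.≟ b
  ... | no _  = refl
  ... | yes e with j
  ...   | zero   = ⊥-elim (ne (trans (cong (arr o) (+-identityʳ k)) e))
  ...   | suc j′ = cong suc (run-suc-fuel b (suc k) f j′ (≤-pred j<f) (λ e′ → ne (trans (cong (arr o) (+-suc k j′)) e′)))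

  run-not-+-run : ∀ b k f → run o (not b) k f + run o b k f ≡ run o (arr o k) k f
  run-not-+-run b k f with arr o k in e
  run-not-+-run true  k f | true  = cong (_+ run o true k f) (run-stop f (not-¬ e))
  run-not-+-run false k f | false = cong (_+ run o false k f) (run-stop f (not-¬ e))
  run-not-+-run true  k f | false = trans (cong (run o false k f +_) (run-stop f (not-¬ e))) (+-identityʳ _)
  run-not-+-run false k f | true  = trans (cong (run o true k f +_) (run-stop f (not-¬ e))) (+-identityʳ _)

  sigmaEntries sigmaTildeEntries : ℕ → List ℕ
  sigmaEntries      u = if prevArr o u then [] else [ run o true u n + 2 ]
  sigmaTildeEntries u = if prevArr o u then [ run o false u n + 2 ] else []

  vertexWeight : ℕ → ℕ
  vertexWeight u = sum (sigmaEntries u) + sum (sigmaTildeEntries u)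

  vertexWeight≡2+run : ∀ u → vertexWeight u ≡ 2 + run o (not (prevArr o u)) u n
  vertexWeight≡2+run u with prevArr o u
  ... | true  = trans (+-identityʳ _) (+-comm _ 2)
  ... | false = trans (+-identityʳ _) (trans (+-identityʳ _) (+-comm _ 2))

  runThrough : ℕ → ℕ
  runThrough u = run o (prevArr o u) u n

  runThrough-periodic : runThrough n ≡ runThrough 0
  runThrough-periodic = trans (cong (λ b → run o b n n) prevArr-periodic) (run-periodic _ 0 n)

  sigma-skeletal : All (1 <_) (sigma o)
  sigma-skeletal = All-concatMap-upTo⁺ sigmaEntries n entries-skeletal
    where
    entries-skeletal : ∀ u → All (1 <_) (sigmaEntries u)
    entries-skeletal u with prevArr o u
    ... | true  = []
    ... | false = m≤n+m 2 _ ∷ []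

  sigmaTilde-skeletal : All (1 <_) (sigmaTilde o)
  sigmaTilde-skeletal = All-concatMap-upTo⁺ sigmaTildeEntries n entries-skeletal
    where
    entries-skeletal : ∀ u → All (1 <_) (sigmaTildeEntries u)
    entries-skeletal u with prevArr o u
    ... | true  = m≤n+m 2 _ ∷ []
    ... | false = []

  run+2≢2 : ∀ {b k} → arr o k ≡ b → run o b k n + 2 ≢ 2
  run+2≢2 e = >⇒≢ (m<n+m 2 (subst (0 <_) (sym (run-step m e)) z<s))

  sigma-nontrivial : VertexOneSource o → ¬ All (_≡ 2) (sigma o)
  sigma-nontrivial (arr0≡true , arrLast≡false) all≡2
    with All-concatMap-upTo⁻ sigmaEntries n all≡2 {0} z<s
  ... | entries≡2 rewrite arrLast≡false with entries≡2
  ...   | entry≡2 ∷ [] = run+2≢2 arr0≡true entry≡2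

  sigmaTilde-nontrivial : VertexOneSource o → ¬ All (_≡ 2) (sigmaTilde o)
  sigmaTilde-nontrivial (arr0≡true , arrLast≡false) all≡2
    with switch-true-false (arr o) arr0≡true m arrLast≡false
  ... | k , k<m , arrk≡true , arrk+1≡false
    with All-concatMap-upTo⁻ sigmaTildeEntries n all≡2 (s≤s k<m)
  ... | entries≡2 rewrite prevArr-suc k | arrk≡true with entries≡2
  ...   | entry≡2 ∷ [] = run+2≢2 arrk+1≡false entry≡2

  module _ (nonOriented : NonOriented o) where

    opposite-arrow : ∀ b → ∃ λ i → o i ≢ b
    opposite-arrow true  = let _ , i , _ , oi≡false = nonOriented in i , not-¬ oi≡false
    opposite-arrow false = let i , _ , oi≡true , _  = nonOriented in i , not-¬ oi≡true

    arr-mismatch : ∀ b k → ∃ λ j → j < n × arr o (k + j) ≢ b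
    arr-mismatch b k with opposite-arrow b
    ... | i , oi≢b = j₀ % n , m%n<n j₀ n , λ e → oi≢b (trans (sym (arr-index i (k + j₀ % n) hits-i)) e)
      where
      t j₀ : ℕ
      t = toℕ i
      j₀ = t + k * n ∸ k
      hits-i : (k + j₀ % n) % n ≡ t
      hits-i = begin
        (k + j₀ % n) % n           ≡⟨ %-distribˡ-+ k (j₀ % n) n ⟩
        (k % n + j₀ % n % n) % n   ≡⟨ cong (λ x → (k % n + x) % n) (m%n%n≡m%n j₀ n) ⟩
        (k % n + j₀ % n) % n       ≡⟨ sym (%-distribˡ-+ k j₀ n) ⟩
        (k + j₀) % n               ≡⟨ cong (_% n) (m+[n∸m]≡n (≤-trans (m≤m*n k n) (m≤n+m (k * n) t))) ⟩
        (t + k * n) % n            ≡⟨ [m+kn]%n≡m%n t k n ⟩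
        t % n                      ≡⟨ m<n⇒m%n≡m (toℕ<n i) ⟩
        t                          ∎
        where open ≡-Reasoning

    -- Fuel n suffices because in a non-oriented quiver every run stops before n arrows.
    run-unfold : ∀ {b k} → arr o k ≡ b → run o b k n ≡ suc (run o b (suc k) n)
    run-unfold {b} {k} e with arr-mismatch b k
    ... | zero   , _   , ne = ⊥-elim (ne (trans (cong (arr o) (+-identityʳ k)) e))
    ... | suc j , j<n , ne = trans (run-step m e) (cong suc (sym
          (run-suc-fuel b (suc k) m j (≤-pred j<n) (λ e′ → ne (trans (cong (arr o) (+-suc k j)) e′)))))

    vertexWeight-step : ∀ u → vertexWeight u + runThrough u ≡ 3 + runThrough (suc u)
    vertexWeight-step u = begin
      vertexWeight u + run o p u n                 ≡⟨ cong (_+ run o p u n) (vertexWeight≡2+run u) ⟩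
      2 + run o (not p) u n + run o p u n          ≡⟨ +-assoc 2 (run o (not p) u n) _ ⟩
      2 + (run o (not p) u n + run o p u n)        ≡⟨ cong (2 +_) (run-not-+-run p u n) ⟩
      2 + run o (arr o u) u n                      ≡⟨ cong (2 +_) (run-unfold refl) ⟩
      3 + run o (arr o u) (suc u) n                ≡⟨ cong (λ b → 3 + run o b (suc u) n) (sym (prevArr-suc u)) ⟩
      3 + runThrough (suc u)                       ∎
      where
      open ≡-Reasoning
      p : Bool
      p = prevArr o u

    total-weight : sum (sigma o) + sum (sigmaTilde o) ≡ 3 * n
    total-weight = begin
      sum (sigma o) + sum (sigmaTilde o)
        ≡⟨ cong₂ _+_ (sum-concatMap sigmaEntries (upTo n)) (sum-concatMap sigmaTildeEntries (upTo n)) ⟩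
      sum (map (λ u → sum (sigmaEntries u)) (upTo n)) + sum (map (λ u → sum (sigmaTildeEntries u)) (upTo n))
        ≡⟨ sum-map-+ (λ u → sum (sigmaEntries u)) (λ u → sum (sigmaTildeEntries u)) (upTo n) ⟩
      sum (map vertexWeight (upTo n))
        ≡⟨ cong sum (map-upTo vertexWeight n) ⟩
      sum (applyUpTo vertexWeight n)
        ≡⟨ +-cancelʳ-≡ (runThrough 0) _ _ (trans
             (sum-applyUpTo-telescoping vertexWeight runThrough 3 n vertexWeight-step)
             (cong (n * 3 +_) runThrough-periodic)) ⟩
      n * 3
        ≡⟨ *-comm n 3 ⟩
      3 * n ∎
      where open ≡-Reasoning

lemma3p18 : (n : ℕ) .{{_ : NonZero n}} (o : Fin n → Bool) →
    NonOriented o → VertexOneSource o →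
    ((IsQuiddity (sigma o) × All (1 <_) (sigma o) × ¬ All (_≡ 2) (sigma o)) ×
     (IsQuiddity (sigmaTilde o) × All (1 <_) (sigmaTilde o) × ¬ All (_≡ 2) (sigmaTilde o))) ×
    (sum (sigma o) + sum (sigmaTilde o) ≡ 3 * n)
lemma3p18 zero _ _ _ = ⊥-elim (<-irrefl refl (>-nonZero⁻¹ 0))
lemma3p18 (suc m) o nonOriented source =
  ((skeletal⇒quiddity _ (¬All⇒nonZero-length _ σ-nontrivial) sigma-skeletal , sigma-skeletal , σ-nontrivial) ,
   (skeletal⇒quiddity _ (¬All⇒nonZero-length _ σ̃-nontrivial) sigmaTilde-skeletal , sigmaTilde-skeletal , σ̃-nontrivial)) ,
  total-weight nonOriented
  where
  open CyclicQuiver o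
  σ-nontrivial : ¬ All (_≡ 2) (sigma o)
  σ-nontrivial = sigma-nontrivial source
  σ̃-nontrivial : ¬ All (_≡ 2) (sigmaTilde o)
  σ̃-nontrivial = sigmaTilde-nontrivial source
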